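{- Let $n$ be a positive integer and let $t,t',r\in \mathbb{Z}$ with $\gcd(r,n)=1$. (i) If $\gcd(t,n)=\gcd(t',n)$ then $\kappa(n,r,t)=\kappa(n,r,t')$. (ii) If $t\neq 0$ and $t\mid t'$ then $\kappa(n,r,t')\mid \kappa(n,r,t)$, and $\kappa(n,r,t)=\kappa(n,r,t')\gcd\left(\frac{ \kappa(n,r,t)}{|r|_n},\frac{t'}{t}\right)$. (iii) If $d\geqslant 1$ is a divisor of $n$ then, for all integers $\ell, k\geqslant 0$, $S_{\ell k|r|_d}(r)\equiv \ell S_{ k|r|_d}(r)\pmod d$.
   Context: $|r|_m$ is the multiplicative order of $r$ modulo $m$ (for $\gcd(r,m)=1$). $S_k(x)=1+x+\cdots+x^{k-1}$ for $k\ge1$ and $S_0(x)=0$. $\kappa(n,r,t)=\dfrac{n|r|_n}{\gcd(n,\ tS_{|r|_n}(r))}$. -}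

module Defs where

open import Data.Nat.Base as ℕ using (ℕ; zero; suc; NonZero; _≤_; _<_; ≢-nonZero; >-nonZero; ≢-nonZero⁻¹)
open import Data.Nat.GCD using (gcd; gcd[m,n]≢0)

open import Data.Integer.Base as ℤ using (ℤ; +_; _-_; _^_; ∣_∣; 0ℤ; 1ℤ)
open import Data.Integer.Divisibility using (_∣_)
open import Data.Sum.Base using (inj₁)
open import Relation.Nullary using (¬_)

S : ℕ → ℤ → ℤ
S zero    x = 0ℤ
S (suc k) x = S k x ℤ.+ x ^ k

record IsMultOrder (r : ℤ) (m : ℕ) (k : ℕ) : Set where
  field
    pos     : 1 ≤ k
    divides : (+ m) ∣ (r ^ k - 1ℤ)
    least   : ∀ j → 1 ≤ j → j < k → ¬ ((+ m) ∣ (r ^ j - 1ℤ))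

gcd-nonZero : ∀ n x → .{{NonZero n}} → NonZero (gcd n x)
gcd-nonZero n x = ≢-nonZero (gcd[m,n]≢0 n x (inj₁ (≢-nonZero⁻¹ n)))

-- κ(n,r,t) = n |r|_n / gcd(n, t S_{|r|_n}(r)), where o = |r|_n is supplied
κ : (n : ℕ) → .{{NonZero n}} → (o : ℕ) → (r t : ℤ) → ℕ
κ n o r t = ℕ._/_ (n ℕ.* o) (gcd n ∣ t ℤ.* S o r ∣) {{gcd-nonZero n ∣ t ℤ.* S o r ∣}}

_/ord_ : ℕ → (o : ℕ) → {r : ℤ} {m : ℕ} → IsMultOrder r m o → ℕ
(a /ord o) h = ℕ._/_ a o {{>-nonZero (IsMultOrder.pos h)}}

{-# OPTIONS --safe #-}
module Submission where

-- Write g = gcd(n, x) and n = g·A.  Since A is coprime to x/g, gcd(n, x·k) = g·gcd(A, k).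
-- As κ(n,r,t) = (n / gcd(n, t·S_o(r)))·o with o = |r|_n, this shows that κ depends on t
-- only through gcd(n, t), which is (i), and that multiplying t by k divides κ by gcd(A, k)
-- with A = κ(n,r,t)/o, which is (ii).  For (iii), S_{a+b} = S_a + r^a·S_b and
-- r^m ≡ 1 (mod d) for m = |r|_d give S_{j·m} ≡ j·S_m (mod d); use it for j = ℓk and j = k.

open import Defs
open import Data.Nat.Base as ℕ using (ℕ; NonZero; _≤_)
open import Data.Nat.Divisibility as ℕD using ()
open import Data.Nat.GCD using (gcd)
open import Data.Integer.Base as ℤ using (ℤ; +_; _-_; ∣_∣; 0ℤ)
open import Data.Integer.Divisibility using (_∣_)
open import Data.Product using (_×_; _,_)
open import Relation.Binary.PropositionalEquality
  using (_≡_; _≢_; sym; trans; cong; cong₂; subst; module ≡-Reasoning)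
open import Data.Nat.Coprimality using (Coprime; coprime-divisor; coprime-/gcd)
import Data.Nat.Properties as ℕP
import Data.Nat.GCD as GCD
import Data.Nat.DivMod as DivMod
import Data.Integer.Properties as ℤP
import Data.Integer.Divisibility.Signed as ℤD
import Data.Integer.Tactic.RingSolver as ℤSolver

instance
  gcd≢0 : ∀ {m n} .{{_ : NonZero m}} → NonZero (gcd m n)
  gcd≢0 {m} {n} = gcd-nonZero m n

coprime⇒gcd[m,n*k]≡gcd[m,k] : ∀ {m n} k → Coprime m n → gcd m (n ℕ.* k) ≡ gcd m k
coprime⇒gcd[m,n*k]≡gcd[m,k] {m} {n} k m⊥n = ℕD.∣-antisym g∣gcd[m,k] gcd[m,k]∣g
  where
  g = gcd m (n ℕ.* k)
  g∣m : g ℕD.∣ m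
  g∣m = GCD.gcd[m,n]∣m m (n ℕ.* k)
  g⊥n : Coprime g n
  g⊥n (d∣g , d∣n) = m⊥n (ℕD.∣-trans d∣g g∣m , d∣n)
  g∣gcd[m,k] : g ℕD.∣ gcd m k
  g∣gcd[m,k] = GCD.gcd-greatest g∣m (coprime-divisor g⊥n (GCD.gcd[m,n]∣n m (n ℕ.* k)))
  gcd[m,k]∣g : gcd m k ℕD.∣ g
  gcd[m,k]∣g = GCD.gcd-greatest (GCD.gcd[m,n]∣m m k)
    (ℕD.∣-trans (GCD.gcd[m,n]∣n m k) (ℕD.n∣m*n n))

gcd[m,n*k]≡gcd[m,n]*gcd[m/gcd[m,n],k] : ∀ m n k .{{_ : NonZero m}} →
  gcd m (n ℕ.* k) ≡ gcd m n ℕ.* gcd (m ℕ./ gcd m n) k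
gcd[m,n*k]≡gcd[m,n]*gcd[m/gcd[m,n],k] m n k = begin
  gcd m (n ℕ.* k)
    ≡⟨ cong₂ gcd (sym (DivMod.m*[n/m]≡n (GCD.gcd[m,n]∣m m n))) n*k≡g*[n/g*k] ⟩
  gcd (g ℕ.* (m ℕ./ g)) (g ℕ.* (n ℕ./ g ℕ.* k))
    ≡⟨ GCD.c*gcd[m,n]≡gcd[cm,cn] g (m ℕ./ g) (n ℕ./ g ℕ.* k) ⟨
  g ℕ.* gcd (m ℕ./ g) (n ℕ./ g ℕ.* k)
    ≡⟨ cong (g ℕ.*_) (coprime⇒gcd[m,n*k]≡gcd[m,k] k (coprime-/gcd m n)) ⟩
  g ℕ.* gcd (m ℕ./ g) k
    ∎
  where
  open ≡-Reasoning
  g = gcd m n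
  n*k≡g*[n/g*k] : n ℕ.* k ≡ g ℕ.* (n ℕ./ g ℕ.* k)
  n*k≡g*[n/g*k] = trans (cong (ℕ._* k) (sym (DivMod.m*[n/m]≡n (GCD.gcd[m,n]∣n m n))))
                        (ℕP.*-assoc g (n ℕ./ g) k)

gcd[m,n]≡gcd[m,n′]⇒gcd[m,n*k]≡gcd[m,n′*k] : ∀ m {n n′} k .{{_ : NonZero m}} →
  gcd m n ≡ gcd m n′ → gcd m (n ℕ.* k) ≡ gcd m (n′ ℕ.* k)
gcd[m,n]≡gcd[m,n′]⇒gcd[m,n*k]≡gcd[m,n′*k] m {n} {n′} k eq = begin
  gcd m (n ℕ.* k)                      ≡⟨ gcd[m,n*k]≡gcd[m,n]*gcd[m/gcd[m,n],k] m n k ⟩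
  gcd m n ℕ.* gcd (m ℕ./ gcd m n) k    ≡⟨ cong₂ ℕ._*_ eq (cong (λ a → gcd a k) (DivMod./-congʳ eq)) ⟩
  gcd m n′ ℕ.* gcd (m ℕ./ gcd m n′) k  ≡⟨ gcd[m,n*k]≡gcd[m,n]*gcd[m/gcd[m,n],k] m n′ k ⟨
  gcd m (n′ ℕ.* k)                     ∎
  where open ≡-Reasoning

m/gcd[m,n*k]*gcd[m/gcd[m,n],k]≡m/gcd[m,n] : ∀ m n k .{{_ : NonZero m}} →
  m ℕ./ gcd m (n ℕ.* k) ℕ.* gcd (m ℕ./ gcd m n) k ≡ m ℕ./ gcd m n
m/gcd[m,n*k]*gcd[m/gcd[m,n],k]≡m/gcd[m,n] m n k = begin
  m ℕ./ gcd m (n ℕ.* k) ℕ.* e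
    ≡⟨ cong (ℕ._* e) (DivMod./-congʳ {{_}} {{g*e≢0}} (gcd[m,n*k]≡gcd[m,n]*gcd[m/gcd[m,n],k] m n k)) ⟩
  (m ℕ./ (g ℕ.* e)) {{g*e≢0}} ℕ.* e
    ≡⟨ cong (ℕ._* e) (DivMod.m/n/o≡m/[n*o] m g e {{_}} {{e≢0}} {{g*e≢0}}) ⟨
  (m ℕ./ g ℕ./ e) {{e≢0}} ℕ.* e
    ≡⟨ DivMod.m/n*n≡m {{e≢0}} (GCD.gcd[m,n]∣m (m ℕ./ g) k) ⟩
  m ℕ./ g
    ∎
  where
  open ≡-Reasoning
  g = gcd m n
  e = gcd (m ℕ./ g) k
  e≢0 : NonZero e
  e≢0 = gcd-nonZero (m ℕ./ g) k {{ℕ.≢-nonZero (GCD.m/gcd[m,n]≢0 m n)}}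
  g*e≢0 : NonZero (g ℕ.* e)
  g*e≢0 = ℕP.m*n≢0 g e {{gcd-nonZero m n}} {{e≢0}}

m*o/d≡m/d*o : ∀ m o {d} .{{_ : NonZero d}} → d ℕD.∣ m → m ℕ.* o ℕ./ d ≡ m ℕ./ d ℕ.* o
m*o/d≡m/d*o m o {d} d∣m = begin
  m ℕ.* o ℕ./ d    ≡⟨ DivMod./-congˡ (ℕP.*-comm m o) ⟩
  o ℕ.* m ℕ./ d    ≡⟨ DivMod.*-/-assoc o d∣m ⟩
  o ℕ.* (m ℕ./ d)  ≡⟨ ℕP.*-comm o (m ℕ./ d) ⟩
  m ℕ./ d ℕ.* o    ∎
  where open ≡-Reasoning

m*o/gcd[m,n]≡m*o/gcd[m,n*k]*gcd[m*o/gcd[m,n]/o,k] :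
  ∀ m o n k .{{_ : NonZero m}} .{{_ : NonZero o}} →
  m ℕ.* o ℕ./ gcd m n ≡ m ℕ.* o ℕ./ gcd m (n ℕ.* k) ℕ.* gcd (m ℕ.* o ℕ./ gcd m n ℕ./ o) k
m*o/gcd[m,n]≡m*o/gcd[m,n*k]*gcd[m*o/gcd[m,n]/o,k] m o n k = begin
  m ℕ.* o ℕ./ g          ≡⟨ m*o/g≡m/g*o n ⟩
  m ℕ./ g ℕ.* o          ≡⟨ cong (ℕ._* o) (m/gcd[m,n*k]*gcd[m/gcd[m,n],k]≡m/gcd[m,n] m n k) ⟨
  m ℕ./ g′ ℕ.* e ℕ.* o   ≡⟨ ℕP.*-assoc (m ℕ./ g′) e o ⟩
  m ℕ./ g′ ℕ.* (e ℕ.* o) ≡⟨ cong (m ℕ./ g′ ℕ.*_) (ℕP.*-comm e o) ⟩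
  m ℕ./ g′ ℕ.* (o ℕ.* e) ≡⟨ ℕP.*-assoc (m ℕ./ g′) o e ⟨
  m ℕ./ g′ ℕ.* o ℕ.* e
    ≡⟨ cong₂ ℕ._*_ (m*o/g≡m/g*o (n ℕ.* k)) (cong (λ a → gcd a k) m*o/g/o≡m/g) ⟨
  m ℕ.* o ℕ./ g′ ℕ.* gcd (m ℕ.* o ℕ./ g ℕ./ o) k
    ∎
  where
  open ≡-Reasoning
  g = gcd m n
  g′ = gcd m (n ℕ.* k)
  e = gcd (m ℕ./ g) k
  m*o/g≡m/g*o : ∀ x → m ℕ.* o ℕ./ gcd m x ≡ m ℕ./ gcd m x ℕ.* o
  m*o/g≡m/g*o x = m*o/d≡m/d*o m o (GCD.gcd[m,n]∣m m x)
  m*o/g/o≡m/g : m ℕ.* o ℕ./ g ℕ./ o ≡ m ℕ./ g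
  m*o/g/o≡m/g = trans (DivMod./-congˡ (m*o/g≡m/g*o n)) (DivMod.m*n/n≡m (m ℕ./ g) o)

S[a+b]≡S[a]+x^a*S[b] : ∀ a b x → S (a ℕ.+ b) x ≡ S a x ℤ.+ x ℤ.^ a ℤ.* S b x
S[a+b]≡S[a]+x^a*S[b] a ℕ.zero x = begin
  S (a ℕ.+ 0) x           ≡⟨ cong (λ c → S c x) (ℕP.+-identityʳ a) ⟩
  S a x                   ≡⟨ ℤP.+-identityʳ (S a x) ⟨
  S a x ℤ.+ 0ℤ            ≡⟨ cong (λ z → S a x ℤ.+ z) (ℤP.*-zeroʳ (x ℤ.^ a)) ⟨
  S a x ℤ.+ x ℤ.^ a ℤ.* 0ℤ ∎
  where open ≡-Reasoning
S[a+b]≡S[a]+x^a*S[b] a (ℕ.suc b) x = begin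
  S (a ℕ.+ ℕ.suc b) x
    ≡⟨ cong (λ c → S c x) (ℕP.+-suc a b) ⟩
  S (a ℕ.+ b) x ℤ.+ x ℤ.^ (a ℕ.+ b)
    ≡⟨ cong₂ ℤ._+_ (S[a+b]≡S[a]+x^a*S[b] a b x) (ℤP.^-distribˡ-+-* x a b) ⟩
  S a x ℤ.+ x ℤ.^ a ℤ.* S b x ℤ.+ x ℤ.^ a ℤ.* x ℤ.^ b
    ≡⟨ ℤP.+-assoc (S a x) (x ℤ.^ a ℤ.* S b x) (x ℤ.^ a ℤ.* x ℤ.^ b) ⟩
  S a x ℤ.+ (x ℤ.^ a ℤ.* S b x ℤ.+ x ℤ.^ a ℤ.* x ℤ.^ b)
    ≡⟨ cong (λ z → S a x ℤ.+ z) (ℤP.*-distribˡ-+ (x ℤ.^ a) (S b x) (x ℤ.^ b)) ⟨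
  S a x ℤ.+ x ℤ.^ a ℤ.* (S b x ℤ.+ x ℤ.^ b)
    ∎
  where open ≡-Reasoning

∣x^m-1⇒∣S[ℓ*m]-ℓ*S[m] : ∀ {d x} m → d ℤD.∣ x ℤ.^ m - ℤ.1ℤ →
  ∀ ℓ → d ℤD.∣ S (ℓ ℕ.* m) x - + ℓ ℤ.* S m x
∣x^m-1⇒∣S[ℓ*m]-ℓ*S[m] {d} {x} m d∣x^m-1 ℕ.zero =
  ℤD.divides 0ℤ (trans (cong (0ℤ -_) (ℤP.*-zeroˡ (S m x))) (sym (ℤP.*-zeroˡ d)))
∣x^m-1⇒∣S[ℓ*m]-ℓ*S[m] {d} {x} m d∣x^m-1 (ℕ.suc ℓ) =
  subst (d ℤD.∣_) (sym step) (ℤD.∣m∣n⇒∣m+n (ℤD.∣m⇒∣m*n (S (ℓ ℕ.* m) x) d∣x^m-1)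
                                           (∣x^m-1⇒∣S[ℓ*m]-ℓ*S[m] m d∣x^m-1 ℓ))
  where
  step : S (ℕ.suc ℓ ℕ.* m) x - + ℕ.suc ℓ ℤ.* S m x
       ≡ (x ℤ.^ m - ℤ.1ℤ) ℤ.* S (ℓ ℕ.* m) x ℤ.+ (S (ℓ ℕ.* m) x - + ℓ ℤ.* S m x)
  step = trans (cong (_- + ℕ.suc ℓ ℤ.* S m x) (S[a+b]≡S[a]+x^a*S[b] m (ℓ ℕ.* m) x))
               (identity (S m x) (x ℤ.^ m) (S (ℓ ℕ.* m) x) (+ ℓ))
    where
    identity : ∀ s y a l →
      s ℤ.+ y ℤ.* a - (ℤ.1ℤ ℤ.+ l) ℤ.* s ≡ (y - ℤ.1ℤ) ℤ.* a ℤ.+ (a - l ℤ.* s)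
    identity = ℤSolver.solve-∀

∣x^m-1⇒∣S[ℓ*[k*m]]-ℓ*S[k*m] : ∀ {d x} m → d ℤD.∣ x ℤ.^ m - ℤ.1ℤ →
  ∀ ℓ k → d ℤD.∣ S (ℓ ℕ.* (k ℕ.* m)) x - + ℓ ℤ.* S (k ℕ.* m) x
∣x^m-1⇒∣S[ℓ*[k*m]]-ℓ*S[k*m] {d} {x} m d∣x^m-1 ℓ k =
  subst (d ℤD.∣_) regroup (ℤD.∣m∣n⇒∣m-n (∣x^m-1⇒∣S[ℓ*m]-ℓ*S[m] m d∣x^m-1 (ℓ ℕ.* k))
                                       (ℤD.∣n⇒∣m*n (+ ℓ) (∣x^m-1⇒∣S[ℓ*m]-ℓ*S[m] m d∣x^m-1 k)))
  where
  identity : ∀ a b s l c → (a - l ℤ.* c ℤ.* s) - l ℤ.* (b - c ℤ.* s) ≡ a - l ℤ.* b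
  identity = ℤSolver.solve-∀
  regroup : (S (ℓ ℕ.* k ℕ.* m) x - + (ℓ ℕ.* k) ℤ.* S m x) - + ℓ ℤ.* (S (k ℕ.* m) x - + k ℤ.* S m x)
          ≡ S (ℓ ℕ.* (k ℕ.* m)) x - + ℓ ℤ.* S (k ℕ.* m) x
  regroup = trans
    (cong₂ (λ j c → (S j x - c ℤ.* S m x) - + ℓ ℤ.* (S (k ℕ.* m) x - + k ℤ.* S m x))
           (ℕP.*-assoc ℓ k m) (ℤP.pos-* ℓ k))
    (identity (S (ℓ ℕ.* (k ℕ.* m)) x) (S (k ℕ.* m) x) (S m x) (+ ℓ) (+ k))

gcd[∣t∣,n]≡gcd[∣t′∣,n]⇒κ[t]≡κ[t′] : ∀ n .{{_ : NonZero n}} o r t t′ →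
  gcd (∣ t ∣) n ≡ gcd (∣ t′ ∣) n → κ n o r t ≡ κ n o r t′
gcd[∣t∣,n]≡gcd[∣t′∣,n]⇒κ[t]≡κ[t′] n o r t t′ eq = DivMod./-congʳ (begin
  gcd n ∣ t ℤ.* s ∣
    ≡⟨ cong (gcd n) (ℤP.abs-* t s) ⟩
  gcd n (∣ t ∣ ℕ.* ∣ s ∣)
    ≡⟨ gcd[m,n]≡gcd[m,n′]⇒gcd[m,n*k]≡gcd[m,n′*k] n ∣ s ∣ gcd[n,∣t∣]≡gcd[n,∣t′∣] ⟩
  gcd n (∣ t′ ∣ ℕ.* ∣ s ∣)
    ≡⟨ cong (gcd n) (ℤP.abs-* t′ s) ⟨
  gcd n ∣ t′ ℤ.* s ∣
    ∎)
  where
  open ≡-Reasoning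
  s = S o r
  gcd[n,∣t∣]≡gcd[n,∣t′∣] : gcd n ∣ t ∣ ≡ gcd n ∣ t′ ∣
  gcd[n,∣t∣]≡gcd[n,∣t′∣] = trans (GCD.gcd-comm n ∣ t ∣) (trans eq (GCD.gcd-comm ∣ t′ ∣ n))

∣t′∣≡Q*∣t∣⇒κ[t]≡κ[t′]*gcd[κ[t]/o,Q] :
  ∀ n .{{_ : NonZero n}} o .{{_ : NonZero o}} r t t′ Q →
  ∣ t′ ∣ ≡ Q ℕ.* ∣ t ∣ → κ n o r t ≡ κ n o r t′ ℕ.* gcd (κ n o r t ℕ./ o) Q
∣t′∣≡Q*∣t∣⇒κ[t]≡κ[t′]*gcd[κ[t]/o,Q] n o r t t′ Q eq =
  trans (m*o/gcd[m,n]≡m*o/gcd[m,n*k]*gcd[m*o/gcd[m,n]/o,k] n o ∣ t ℤ.* s ∣ Q)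
        (cong (ℕ._* gcd (κ n o r t ℕ./ o) Q)
              (DivMod./-congʳ {m = n ℕ.* o} (cong (gcd n) ∣t*s∣*Q≡∣t′*s∣)))
  where
  open ≡-Reasoning
  s = S o r
  ∣t*s∣*Q≡∣t′*s∣ : ∣ t ℤ.* s ∣ ℕ.* Q ≡ ∣ t′ ℤ.* s ∣
  ∣t*s∣*Q≡∣t′*s∣ = begin
    ∣ t ℤ.* s ∣ ℕ.* Q        ≡⟨ ℕP.*-comm ∣ t ℤ.* s ∣ Q ⟩
    Q ℕ.* ∣ t ℤ.* s ∣        ≡⟨ cong (Q ℕ.*_) (ℤP.abs-* t s) ⟩
    Q ℕ.* (∣ t ∣ ℕ.* ∣ s ∣)  ≡⟨ ℕP.*-assoc Q ∣ t ∣ ∣ s ∣ ⟨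
    Q ℕ.* ∣ t ∣ ℕ.* ∣ s ∣    ≡⟨ cong (ℕ._* ∣ s ∣) eq ⟨
    ∣ t′ ∣ ℕ.* ∣ s ∣         ≡⟨ ℤP.abs-* t′ s ⟨
    ∣ t′ ℤ.* s ∣             ∎

lemma3p2 : (n : ℕ) → .{{_ : NonZero n}} → (r : ℤ) → gcd (∣ r ∣) n ≡ 1 →
    (o : ℕ) → (h : IsMultOrder r n o) →
    -- (i)
    (∀ (t t' : ℤ) → gcd (∣ t ∣) n ≡ gcd (∣ t' ∣) n → κ n o r t ≡ κ n o r t')
    -- (ii)
    × (∀ (t t' : ℤ) → t ≢ 0ℤ → t ∣ t' →
        (κ n o r t' ℕD.∣ κ n o r t)
        × (∀ (q : ℤ) → t' ≡ q ℤ.* t →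
            κ n o r t ≡ κ n o r t' ℕ.* gcd ((κ n o r t /ord o) h) (∣ q ∣)))
    -- (iii)
    × (∀ (d : ℕ) → 1 ≤ d → d ℕD.∣ n → (od : ℕ) → IsMultOrder r d od →
        ∀ (ℓ k : ℕ) → (+ d) ∣ (S (ℓ ℕ.* (k ℕ.* od)) r - (+ ℓ) ℤ.* S (k ℕ.* od) r))
lemma3p2 n r _ o h =
  gcd[∣t∣,n]≡gcd[∣t′∣,n]⇒κ[t]≡κ[t′] n o r ,
  (λ t t′ _ → part-ii t t′) ,
  λ d _ _ od hd ℓ k → ℤD.∣⇒∣ᵤ {+ d}
    (∣x^m-1⇒∣S[ℓ*[k*m]]-ℓ*S[k*m] od (ℤD.∣ᵤ⇒∣ (IsMultOrder.divides hd)) ℓ k)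
  where
  o≢0 : NonZero o
  o≢0 = ℕ.>-nonZero (IsMultOrder.pos h)
  κ-scaling : ∀ t t′ Q → ∣ t′ ∣ ≡ Q ℕ.* ∣ t ∣ →
    κ n o r t ≡ κ n o r t′ ℕ.* gcd ((κ n o r t /ord o) h) Q
  κ-scaling = ∣t′∣≡Q*∣t∣⇒κ[t]≡κ[t′]*gcd[κ[t]/o,Q] n o {{o≢0}} r
  part-ii : ∀ t t′ → t ∣ t′ → (κ n o r t′ ℕD.∣ κ n o r t)
    × (∀ q → t′ ≡ q ℤ.* t → κ n o r t ≡ κ n o r t′ ℕ.* gcd ((κ n o r t /ord o) h) ∣ q ∣)
  part-ii t t′ (ℕD.divides Q ∣t′∣≡Q*∣t∣) =
    ℕD.divides c (trans (κ-scaling t t′ Q ∣t′∣≡Q*∣t∣) (ℕP.*-comm (κ n o r t′) c)) ,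
    λ q t′≡q*t → κ-scaling t t′ ∣ q ∣ (trans (cong ∣_∣ t′≡q*t) (ℤP.abs-* q t))
    where c = gcd ((κ n o r t /ord o) h) Q
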